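{- Let $(S,\leq)$ be an ordered set, $S'$ an isolated suborder of $(S,\leq)$, and $C$ a closure system of $(S,\leq)$. \begin{enumerate} \item If $C\cap S'=\emptyset$, then $\{\{c\}\mid c\in C\}$ is a closure system of $(S/{\equiv_{S'}},\leq_{\equiv_{S'}})$. \item If $C\cap S'\neq\emptyset$, then $\{\{c\}\mid c\in C\setminus S'\}\cup\{S'\}$ is a closure system of $(S/{\equiv_{S'}},\leq_{\equiv_{S'}})$. \end{enumerate}
   Context: A subset $C$ of an ordered set $(P,\preceq)$ is a closure system if for every $p\in P$ the set $\{y\in C\mid p\preceq y\}$ has a least element. A subset $S'\subseteq S$ is an isolated suborder if (1) $S'$ has a greatest element $\top_{S'}$ and a least element $\bot_{S'}$; (2) for all $x\notin S'$ and $y'\in S'$, $y'\leq x$ implies $\top_{S'}\leq x$; (3) for all $x\notin S'$ and $y'\in S'$, $x\leq y'$ implies $x\leq\bot_{S'}$. The equivalence $\equiv_{S'}$ on $S$ is defined by $x\equiv_{S'}y$ iff ($x\in S'\Leftrightarrow y\in S'$); its classes are $S'$ and the singletons $\{x\}$, $x\notin S'$. The quotient relation $\leq_{\equiv_{S'}}$ on $S/{\equiv_{S'}}$ is defined by $[x]\leq_{\equiv_{S'}}[y]$ iff there exist $x'\in[x]$, $y'\in[y]$ with $x'\leq y'$ (this is an order). -}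

module Defs where

open import Level using (Level; _⊔_)
open import Data.Product using (Σ; ∃; ∃₂; _×_; _,_)
open import Data.Sum using (_⊎_)
open import Relation.Nullary using (¬_)
open import Relation.Unary using (Pred; _∈_; _∉_)
open import Relation.Binary using (Rel)
open import Relation.Binary.PropositionalEquality using (_≡_)

private
  variable
    a ℓ ℓ₁ : Level
    A : Set a

IsClosureSystem : (_≤_ : Rel A ℓ) → Pred A ℓ₁ → Set _
IsClosureSystem {A = A} _≤_ C =
  ∀ p → Σ A λ y → (y ∈ C × p ≤ y) × (∀ z → z ∈ C → p ≤ z → y ≤ z)

record IsIsolatedSuborder {A : Set a} (_≤_ : Rel A ℓ) (S' : Pred A ℓ₁) : Set (a ⊔ ℓ ⊔ ℓ₁) where
  field
    top     : A
    bot     : A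
    top∈    : top ∈ S'
    bot∈    : bot ∈ S'
    greatest : ∀ y → y ∈ S' → y ≤ top
    least    : ∀ y → y ∈ S' → bot ≤ y
    up-closed   : ∀ x y → x ∉ S' → y ∈ S' → y ≤ x → top ≤ x
    down-closed : ∀ x y → x ∉ S' → y ∈ S' → x ≤ y → x ≤ bot

-- The quotient A/≡_{S'} is represented by A itself with this equivalence;
-- a subset of the quotient is a ≡_{S'}-saturated predicate on A.
_≈⟨_⟩_ : A → Pred A ℓ₁ → A → Set _
x ≈⟨ S' ⟩ y = x ≡ y ⊎ (x ∈ S' × y ∈ S')

QuotLe : (_≤_ : Rel A ℓ) (S' : Pred A ℓ₁) → Rel A _
QuotLe _≤_ S' x y = ∃₂ λ x' y' → x' ≈⟨ S' ⟩ x × y' ≈⟨ S' ⟩ y × x' ≤ y'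

-- { {c} ∣ c ∈ C }  (as a saturated predicate:  [x] = [c] = {c} for some c ∈ C)
Singletons : (S' : Pred A ℓ₁) (C : Pred A ℓ) → Pred A _
Singletons {A = A} S' C x = Σ A λ c → c ∈ C × x ≈⟨ S' ⟩ c

SingletonsOrS' : (S' : Pred A ℓ₁) (C : Pred A ℓ) → Pred A _
SingletonsOrS' {A = A} S' C x = (Σ A λ c → (c ∈ C × c ∉ S') × x ≈⟨ S' ⟩ c) ⊎ x ∈ S'

{-# OPTIONS --safe #-}
-- Passing to the quotient only changes comparisons that involve the class S'.
-- An element p ∉ S' lies below S' exactly when p ≤ ⊥, and S' lies below z ∉ S'
-- exactly when ⊤ ≤ z.  If C misses S', the least element of C above the class
-- of p is the least element of C above p (or above ⊤ when p ∈ S').  If some s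
-- lies in C ∩ S', the class S' is closed; for p ∉ S' the least c ∈ C above p
-- still works, because a class below S' lies below ⊥ ≤ s, hence below c ≤ s.
module Submission where

open import Defs
open import Level using (Level; _⊔_; lift; lower)
open import Data.Product using (_×_; _,_; ∃)
open import Data.Sum using (_⊎_; inj₁; inj₂)
open import Data.Empty using (⊥-elim)
open import Relation.Nullary using (¬_; yes; no)
open import Relation.Nullary.Decidable using (map′)
open import Relation.Unary using (Pred; Empty; Satisfiable; Decidable; _∩_; _∈_; _∉_)
open import Relation.Binary using (Rel; IsPreorder; IsPartialOrder)
open import Relation.Binary.PropositionalEquality using (_≡_; refl; subst; subst₂)
open import Axiom.ExcludedMiddle using (ExcludedMiddle)
open import Axiom.DoubleNegationElimination using (em⇒dne)

private
  variable
    a ℓ ℓ₁ ℓ₂ : Level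
    A : Set a

¬Empty⇒Satisfiable : {A : Set a} {P : Pred A ℓ} → ExcludedMiddle (a ⊔ ℓ) → ¬ Empty P → Satisfiable P
¬Empty⇒Satisfiable em P≢∅ = em⇒dne em λ ¬sat → P≢∅ λ x x∈P → ¬sat (x , x∈P)

module _ {S' : Pred A ℓ₁} where

  ≈-∉ : ∀ {x y} → y ∉ S' → x ≈⟨ S' ⟩ y → x ≡ y
  ≈-∉ y∉S' (inj₁ x≡y)        = x≡y
  ≈-∉ y∉S' (inj₂ (_ , y∈S')) = ⊥-elim (y∉S' y∈S')

  ≈-∈ : ∀ {x y} → y ∈ S' → x ≈⟨ S' ⟩ y → x ∈ S'
  ≈-∈ y∈S' (inj₁ refl)       = y∈S'
  ≈-∈ y∈S' (inj₂ (x∈S' , _)) = x∈S'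

  module _ {C : Pred A ℓ₂} where

    Singletons-∈ : Empty (C ∩ S') → ∀ {z} → z ∈ Singletons S' C → z ∈ C × z ∉ S'
    Singletons-∈ C∩S'≡∅ (z , z∈C , inj₁ refl)         = z∈C , λ z∈S' → C∩S'≡∅ z (z∈C , z∈S')
    Singletons-∈ C∩S'≡∅ (c , c∈C , inj₂ (_ , c∈S')) = ⊥-elim (C∩S'≡∅ c (c∈C , c∈S'))

    SingletonsOrS'-∈ : ∀ {z} → z ∈ SingletonsOrS' S' C → (z ∈ C × z ∉ S') ⊎ z ∈ S'
    SingletonsOrS'-∈ (inj₁ (z , z∈C∖S' , inj₁ refl))           = inj₁ z∈C∖S'
    SingletonsOrS'-∈ (inj₁ (c , (_ , c∉S') , inj₂ (_ , c∈S'))) = ⊥-elim (c∉S' c∈S')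
    SingletonsOrS'-∈ (inj₂ z∈S')                                = inj₂ z∈S'

    C⊆SingletonsOrS' : Decidable S' → ∀ {c} → c ∈ C → c ∈ SingletonsOrS' S' C
    C⊆SingletonsOrS' S'? {c} c∈C with S'? c
    ... | yes c∈S' = inj₂ c∈S'
    ... | no  c∉S' = inj₁ (c , (c∈C , c∉S') , inj₁ refl)

module IsolatedSuborder {A : Set a} {_≤_ : Rel A ℓ} {S' : Pred A ℓ₁}
                        (iso : IsIsolatedSuborder _≤_ S') where

  open IsIsolatedSuborder iso

  _≲_ : Rel A _
  _≲_ = QuotLe _≤_ S'

  ≤⇒≲ : ∀ {x y} → x ≤ y → x ≲ y
  ≤⇒≲ x≤y = _ , _ , inj₁ refl , inj₁ refl , x≤y

  ≲-∉-∉⇒≤ : ∀ {x y} → x ∉ S' → y ∉ S' → x ≲ y → x ≤ y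
  ≲-∉-∉⇒≤ x∉S' y∉S' (_ , _ , x'≈x , y'≈y , x'≤y') =
    subst₂ _≤_ (≈-∉ x∉S' x'≈x) (≈-∉ y∉S' y'≈y) x'≤y'

  ≲-∈-∉⇒top≤ : ∀ {x y} → x ∈ S' → y ∉ S' → x ≲ y → top ≤ y
  ≲-∈-∉⇒top≤ {y = y} x∈S' y∉S' (x' , _ , x'≈x , y'≈y , x'≤y') =
    up-closed y x' y∉S' (≈-∈ x∈S' x'≈x) (subst (x' ≤_) (≈-∉ y∉S' y'≈y) x'≤y')

  ≲-∉-∈⇒≤bot : ∀ {x y} → x ∉ S' → y ∈ S' → x ≲ y → x ≤ bot
  ≲-∉-∈⇒≤bot {x = x} x∉S' y∈S' (_ , y' , x'≈x , y'≈y , x'≤y') =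
    down-closed x y' x∉S' (≈-∈ y∈S' y'≈y) (subst (_≤ y') (≈-∉ x∉S' x'≈x) x'≤y')

  module _ (isPreorder : IsPreorder _≡_ _≤_) (S'? : Decidable S') {C : Pred A ℓ₂}
           (closed : IsClosureSystem _≤_ C) where

    open IsPreorder isPreorder using (trans) renaming (refl to ≤-refl)

    upperRepresentative : ∀ p → ∃ λ p̂ → p ≤ p̂ × (∀ {z} → z ∉ S' → p ≲ z → p̂ ≤ z)
    upperRepresentative p with S'? p
    ... | yes p∈S' = top , greatest p p∈S' , λ z∉S' → ≲-∈-∉⇒top≤ p∈S' z∉S'
    ... | no  p∉S' = p , ≤-refl , λ z∉S' → ≲-∉-∉⇒≤ p∉S' z∉S'

    Singletons-isClosureSystem : Empty (C ∩ S') → IsClosureSystem _≲_ (Singletons S' C)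
    Singletons-isClosureSystem C∩S'≡∅ p
      with p̂ , p≤p̂ , p̂-below ← upperRepresentative p
      with c , (c∈C , p̂≤c) , c-least ← closed p̂ =
      c , ((c , c∈C , inj₁ refl) , ≤⇒≲ (trans p≤p̂ p̂≤c)) , c-least-above
      where
      c-least-above : ∀ z → z ∈ Singletons S' C → p ≲ z → c ≲ z
      c-least-above z z∈ p≲z with z∈C , z∉S' ← Singletons-∈ C∩S'≡∅ z∈ =
        ≤⇒≲ (c-least z z∈C (p̂-below z∉S' p≲z))

    SingletonsOrS'-isClosureSystem : ∀ {s} → s ∈ C → s ∈ S'
                                   → IsClosureSystem _≲_ (SingletonsOrS' S' C)
    SingletonsOrS'-isClosureSystem {s} s∈C s∈S' p with S'? p
    ... | yes p∈S' = p , (inj₂ p∈S' , ≤⇒≲ ≤-refl) , λ _ _ p≲z → p≲z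
    ... | no  p∉S' with c , (c∈C , p≤c) , c-least ← closed p =
      c , (C⊆SingletonsOrS' S'? c∈C , ≤⇒≲ p≤c) , c-least-above
      where
      c-least-above : ∀ z → z ∈ SingletonsOrS' S' C → p ≲ z → c ≲ z
      c-least-above z z∈ p≲z with SingletonsOrS'-∈ z∈
      ... | inj₁ (z∈C , z∉S') = ≤⇒≲ (c-least z z∈C (≲-∉-∉⇒≤ p∉S' z∉S' p≲z))
      ... | inj₂ z∈S' =
        c , s , inj₁ refl , inj₂ (s∈S' , z∈S')
          , c-least s s∈C (trans (≲-∉-∈⇒≤bot p∉S' z∈S' p≲z) (least s s∈S'))

lemma5p1 : ∀ {a ℓ} (em : ExcludedMiddle (a ⊔ ℓ)) {A : Set a} (_≤_ : Rel A ℓ)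
    → IsPartialOrder _≡_ _≤_
    → (S' : Pred A ℓ) → IsIsolatedSuborder _≤_ S'
    → (C : Pred A ℓ) → IsClosureSystem _≤_ C
    → (Empty (C ∩ S') → IsClosureSystem (QuotLe _≤_ S') (Singletons S' C))
    × (¬ Empty (C ∩ S') → IsClosureSystem (QuotLe _≤_ S') (SingletonsOrS' S' C))
lemma5p1 {a} em _≤_ po S' iso C closed =
  Singletons-isClosureSystem preorder S'? closed ,
  λ C∩S'≢∅ → let s , s∈C , s∈S' = ¬Empty⇒Satisfiable em C∩S'≢∅
             in SingletonsOrS'-isClosureSystem preorder S'? closed s∈C s∈S'
  where
  open IsolatedSuborder iso
  preorder : IsPreorder _≡_ _≤_
  preorder = IsPartialOrder.isPreorder po

  S'? : Decidable S'
  S'? x = map′ lower lift (em {Level.Lift a (x ∈ S')})
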